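{- If $G$ is a connected graph of diameter $d$ and metric dimension $k$, then \[\frac{TC(\mathcal{H}(G))-1}{d} \leq k \leq TC(\mathcal{H}(G)).\]
   Context: Graphs are finite and simple. The metric dimension of $G$ is the minimum size of a set $R$ of vertices such that for every pair $u\neq v$ there is $x\in R$ with $d(x,u)\neq d(x,v)$. The distance hypergraph $\mathcal{H}(G)$ has vertex set $V(G)$ and, as hyperedges, all balls $B(v,r)=\{u: d(u,v)\leq r\}$ for $v\in V(G)$ and all integers $r\geq 0$. A test cover of a hypergraph is a set of hyperedges such that every vertex is in one of them and for any two distinct vertices one of them contains exactly one of the two; $TC$ denotes the minimum size of a test cover. -}

module Defs where

open import Data.Nat using (ℕ; zero; suc; _≤_)
open import Data.Fin using (Fin)
open import Data.Bool using (Bool; true; false)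
open import Data.Product using (Σ; ∃; ∃-syntax; _×_; _,_)
open import Data.Sum using (_⊎_)
open import Data.List using (List; length)
open import Data.List.Relation.Unary.All using (All)
open import Data.List.Relation.Unary.Any using (Any)
open import Data.List.Relation.Unary.Unique.Propositional using (Unique)
open import Data.Fin.Subset using (Subset; _∈_; _∉_; ∣_∣)
open import Relation.Binary.PropositionalEquality using (_≡_; _≢_)
open import Function.Bundles using (_⇔_)

record Graph (n : ℕ) : Set where
  field
    adj   : Fin n → Fin n → Bool
    sym   : ∀ u v → adj u v ≡ adj v u
    irrefl : ∀ v → adj v v ≡ false

open Graph public

Adj : ∀ {n} → Graph n → Fin n → Fin n → Set
Adj G u v = adj G u v ≡ true

data Walk {n : ℕ} (G : Graph n) : Fin n → Fin n → ℕ → Set where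
  here : ∀ {u} → Walk G u u zero
  step : ∀ {u w v m} → Adj G u w → Walk G w v m → Walk G u v (suc m)

Connected : ∀ {n} → Graph n → Set
Connected G = ∀ u v → ∃[ m ] Walk G u v m

IsDist : ∀ {n} → Graph n → Fin n → Fin n → ℕ → Set
IsDist G u v m = Walk G u v m × (∀ k → Walk G u v k → m ≤ k)

IsDiameter : ∀ {n} → Graph n → ℕ → Set
IsDiameter G d =
  (∀ u v m → IsDist G u v m → m ≤ d) × (∃[ u ] ∃[ v ] IsDist G u v d)

Resolving : ∀ {n} → Graph n → Subset n → Set
Resolving G R = ∀ u v → u ≢ v →
  ∃[ x ] (x ∈ R × ∃[ a ] ∃[ b ] (IsDist G x u a × IsDist G x v b × a ≢ b))

IsMetricDimension : ∀ {n} → Graph n → ℕ → Set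
IsMetricDimension {n} G k =
  (∃[ R ] (Resolving G R × ∣ R ∣ ≡ k)) × (∀ R → Resolving G R → k ≤ ∣ R ∣)

-- Hyperedges of the distance hypergraph H(G): balls B(v,r) = {u : d(v,u) ≤ r},
-- i.e. the vertices reachable from v by a walk of length ≤ r.
IsBall : ∀ {n} → Graph n → Subset n → Set
IsBall {n} G E = ∃[ v ] ∃[ r ] (∀ u → (u ∈ E) ⇔ (∃[ m ] (m ≤ r × Walk G v u m)))

-- A test cover of H(G): a set (duplicate-free list) of hyperedges that covers
-- every vertex and separates every pair of distinct vertices.
IsTestCover : ∀ {n} → Graph n → List (Subset n) → Set
IsTestCover {n} G F =
  Unique F × All (IsBall G) F
  × (∀ u → Any (u ∈_) F)
  × (∀ u v → u ≢ v → Any (λ E → (u ∈ E × v ∉ E) ⊎ (v ∈ E × u ∉ E)) F)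

IsTC : ∀ {n} → Graph n → ℕ → Set
IsTC G t =
  (∃[ F ] (IsTestCover G F × length F ≡ t))
  × (∀ F → IsTestCover G F → t ≤ length F)

-- Lower bound: if E = B(c, r) contains exactly one of u, v, then d(c, u) ≤ r < d(c, v)
-- or vice versa, so the centres of a test cover form a resolving set.
-- Upper bound: if R resolves G and d(x, u) = a < d(x, v) for some x ∈ R, then
-- B(x, a) separates u from v and a < d; hence the d ∣R∣ balls B(x, a) with x ∈ R and
-- a < d, together with one ball of radius d (which is all of V), form a test cover.
module Submission where

open import Defs
open import Data.Nat using (ℕ; _≤_; _*_; _∸_)
open import Data.Product using (_×_)

open import Data.Nat using (zero; suc; _+_; _<_; z≤n; s≤s; s≤s⁻¹)
open import Data.Nat.Properties
  using (≤-refl; ≤-trans; ≤-reflexive; <-≤-trans; <⇒≢; <⇒≱; ≮⇒≥; ≰⇒>; <-cmp;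
         +-suc; +-monoʳ-≤; n≤1+n; *-comm; ∸-monoˡ-≤; anyUpTo?)
open import Data.Nat.Induction using (<-rec)
open import Data.Fin as Fin using (Fin)
open import Data.Fin.Properties using (any?)
open import Data.Fin.Subset using (Subset; _∈_; _∉_; ∣_∣; ⁅_⁆; _∪_; ⊥)
open import Data.Fin.Subset.Properties using (x∈⁅x⁆; p⊆p∪q; q⊆p∪q; ∣⊥∣≡0; ∣⁅x⁆∣≡1)
open import Data.Bool as Bool using (true; false)
open import Data.Product using (∃; ∃-syntax; _,_; proj₁; proj₂)
open import Data.Sum using (_⊎_; inj₁; inj₂; swap)
open import Data.Empty using (⊥-elim)
open import Data.List as List
  using (List; []; _∷_; length; upTo; deduplicate; cartesianProductWith)
open import Data.List.Properties using (length-++; length-map; length-upTo; length-deduplicate)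
open import Data.List.Membership.Propositional using () renaming (_∈_ to _∈ₗ_)
open import Data.List.Membership.Propositional.Properties using (∈-upTo⁺; ∈-map⁺)
open import Data.List.Relation.Unary.All as All using (All; []; _∷_)
open import Data.List.Relation.Unary.Any as Any using (Any; here; there)
import Data.List.Relation.Unary.All.Properties as All
import Data.List.Relation.Unary.Any.Properties as Any
open import Data.List.Relation.Unary.Unique.DecPropositional.Properties using (deduplicate-!)
open import Data.Vec using (tabulate; []; _∷_; here; there)
open import Data.Vec.Properties using (lookup∘tabulate; lookup⇒[]=; []=⇒lookup; ≡-dec)
open import Function using (_∘_; id)
open import Function.Bundles using (_⇔_; mk⇔; Equivalence)
open import Relation.Nullary using (Dec; yes; no; does; proof)
open import Relation.Nullary.Reflects using (Reflects; invert)
open import Relation.Nullary.Decidable using (map′; _×-dec_; dec-true)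
open import Relation.Unary using (Decidable)
open import Relation.Binary.Definitions using (DecidableEquality; tri<; tri≈; tri>)
open import Relation.Binary.PropositionalEquality
  using (_≡_; _≢_; refl; trans; cong; cong₂; subst; setoid)
import Relation.Binary.PropositionalEquality as ≡

open Equivalence using (to; from)

IsLeast : (ℕ → Set) → ℕ → Set
IsLeast P a = P a × (∀ k → P k → a ≤ k)

module _ {P : ℕ → Set} (P? : Decidable P) where

  least : ∀ m → P m → ∃ (IsLeast P)
  least = <-rec (λ m → P m → ∃ (IsLeast P)) descend
    where
    descend : ∀ m → (∀ {j} → j < m → P j → ∃ (IsLeast P)) → P m → ∃ (IsLeast P)
    descend m below pm with anyUpTo? P? m
    ... | yes (j , j<m , pj) = below j<m pj
    ... | no none = m , pm , λ k pk → ≮⇒≥ λ k<m → none (k , k<m , pk)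

∈-tabulate-does : ∀ {m} {P : Fin m → Set} (P? : Decidable P) x →
  x ∈ tabulate (does ∘ P?) ⇔ P x
∈-tabulate-does {P = P} P? x = mk⇔
  (λ x∈ → invert (subst (Reflects (P x))
            (trans (≡.sym (lookup∘tabulate _ x)) ([]=⇒lookup x∈)) (proof (P? x))))
  (λ px → lookup⇒[]= x _ (trans (lookup∘tabulate _ x) (dec-true (P? x) px)))

∣p∪q∣≤∣p∣+∣q∣ : ∀ {m} (p q : Subset m) → ∣ p ∪ q ∣ ≤ ∣ p ∣ + ∣ q ∣
∣p∪q∣≤∣p∣+∣q∣ [] [] = z≤n
∣p∪q∣≤∣p∣+∣q∣ (true ∷ p) (true ∷ q) =
  s≤s (≤-trans (∣p∪q∣≤∣p∣+∣q∣ p q) (+-monoʳ-≤ ∣ p ∣ (n≤1+n ∣ q ∣)))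
∣p∪q∣≤∣p∣+∣q∣ (true ∷ p) (false ∷ q) = s≤s (∣p∪q∣≤∣p∣+∣q∣ p q)
∣p∪q∣≤∣p∣+∣q∣ (false ∷ p) (true ∷ q) =
  ≤-trans (s≤s (∣p∪q∣≤∣p∣+∣q∣ p q)) (≤-reflexive (≡.sym (+-suc ∣ p ∣ ∣ q ∣)))
∣p∪q∣≤∣p∣+∣q∣ (false ∷ p) (false ∷ q) = ∣p∪q∣≤∣p∣+∣q∣ p q

elements : ∀ {m} → Subset m → List (Fin m)
elements [] = []
elements (true ∷ p) = Fin.zero ∷ List.map Fin.suc (elements p)
elements (false ∷ p) = List.map Fin.suc (elements p)

length-elements : ∀ {m} (p : Subset m) → length (elements p) ≡ ∣ p ∣
length-elements [] = refl
length-elements (true ∷ p) = cong suc (trans (length-map Fin.suc (elements p)) (length-elements p))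
length-elements (false ∷ p) = trans (length-map Fin.suc (elements p)) (length-elements p)

∈-elements⁺ : ∀ {m} (p : Subset m) {x} → x ∈ p → x ∈ₗ elements p
∈-elements⁺ (true ∷ p) {Fin.zero} here = here refl
∈-elements⁺ (true ∷ p) {Fin.suc x} (there x∈) = there (∈-map⁺ Fin.suc (∈-elements⁺ p x∈))
∈-elements⁺ (false ∷ p) {Fin.suc x} (there x∈) = ∈-map⁺ Fin.suc (∈-elements⁺ p x∈)

length-cartesianProductWith : ∀ {A B C : Set} (f : A → B → C) xs ys →
  length (cartesianProductWith f xs ys) ≡ length xs * length ys
length-cartesianProductWith f [] ys = refl
length-cartesianProductWith f (x ∷ xs) ys = trans (length-++ (List.map (f x) ys))
  (cong₂ _+_ (length-map (f x) ys) (length-cartesianProductWith f xs ys))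

_≟ₛ_ : ∀ {m} → DecidableEquality (Subset m)
_≟ₛ_ = ≡-dec Bool._≟_

module _ {n : ℕ} (G : Graph n) where

  Within : Fin n → Fin n → ℕ → Set
  Within v u r = ∃[ m ] (m ≤ r × Walk G v u m)

  BallAround : Fin n → ℕ → Subset n → Set
  BallAround c r E = ∀ u → (u ∈ E) ⇔ Within c u r

  Separates : Fin n → Fin n → Subset n → Set
  Separates u v E = (u ∈ E × v ∉ E) ⊎ (v ∈ E × u ∉ E)

  walk? : ∀ m u v → Dec (Walk G u v m)
  walk? zero u v = map′ (λ { refl → here }) (λ { here → refl }) (u Fin.≟ v)
  walk? (suc m) u v =
    map′ (λ (w , uw , wv) → step uw wv) (λ { (step uw wv) → _ , uw , wv })
         (any? λ w → (adj G u w Bool.≟ true) ×-dec walk? m w v)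

  within? : ∀ c r u → Dec (Within c u r)
  within? c r u =
    map′ (λ (m , m<1+r , w) → m , s≤s⁻¹ m<1+r , w) (λ (m , m≤r , w) → m , s≤s m≤r , w)
         (anyUpTo? (λ m → walk? m c u) (suc r))

  distance : Connected G → ∀ u v → ∃ (IsDist G u v)
  distance connected u v = least (λ m → walk? m u v) _ (proj₂ (connected u v))

  dist≤radius : ∀ {c u a r} → IsDist G c u a → Within c u r → a ≤ r
  dist≤radius (_ , shortest) (m , m≤r , w) = ≤-trans (shortest m w) m≤r

  ball : Fin n → ℕ → Subset n
  ball c r = tabulate (does ∘ within? c r)

  ball-BallAround : ∀ c r → BallAround c r (ball c r)
  ball-BallAround c r = ∈-tabulate-does (within? c r)

  ball-IsBall : ∀ c r → IsBall G (ball c r)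
  ball-IsBall c r = c , r , ball-BallAround c r

  separated-by-ball⇒dist< : ∀ {c r E u v a b} → BallAround c r E →
    IsDist G c u a → IsDist G c v b → u ∈ E → v ∉ E → a < b
  separated-by-ball⇒dist< {r = r} {u = u} {v = v} {a = a} {b = b} around du dv u∈ v∉ =
    ≰⇒> λ b≤a → v∉ (from (around v) (b , ≤-trans b≤a a≤r , proj₁ dv))
    where
    a≤r : a ≤ r
    a≤r = dist≤radius du (to (around u) u∈)

  dist<⇒separated-by-ball : ∀ {x u v a b} →
    IsDist G x u a → IsDist G x v b → a < b → Separates u v (ball x a)
  dist<⇒separated-by-ball {x} {u} {v} {a} du dv a<b = inj₁
    ( from (ball-BallAround x a u) (a , ≤-refl , proj₁ du)
    , λ v∈ → <⇒≱ a<b (dist≤radius dv (to (ball-BallAround x a v) v∈)) )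

  centres : ∀ {F} → All (IsBall G) F → Subset n
  centres [] = ⊥
  centres ((c , _) ∷ balls) = ⁅ c ⁆ ∪ centres balls

  ∣centres∣≤length : ∀ {F} (balls : All (IsBall G) F) → ∣ centres balls ∣ ≤ length F
  ∣centres∣≤length [] = ≤-reflexive (∣⊥∣≡0 n)
  ∣centres∣≤length ((c , _) ∷ balls) = ≤-trans (∣p∪q∣≤∣p∣+∣q∣ ⁅ c ⁆ (centres balls))
    (≤-trans (+-monoʳ-≤ ∣ ⁅ c ⁆ ∣ (∣centres∣≤length balls)) (≤-reflexive (cong (_+ _) (∣⁅x⁆∣≡1 c))))

  any-ball-with-centre : ∀ {F} {Q : Subset n → Set} (balls : All (IsBall G) F) → Any Q F →
    ∃[ c ] (c ∈ centres balls × ∃[ r ] ∃[ E ] (BallAround c r E × Q E))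
  any-ball-with-centre ((c , r , around) ∷ _) (here q) =
    c , p⊆p∪q _ (x∈⁅x⁆ c) , r , _ , around , q
  any-ball-with-centre ((c , _) ∷ balls) (there q) with any-ball-with-centre balls q
  ... | c′ , c′∈ , rest = c′ , q⊆p∪q ⁅ c ⁆ _ c′∈ , rest

  centres-resolving : Connected G → ∀ {F} → IsTestCover G F →
    ∃[ R ] (Resolving G R × ∣ R ∣ ≤ length F)
  centres-resolving connected (_ , balls , _ , separating) =
    centres balls , resolves , ∣centres∣≤length balls
    where
    resolves : Resolving G (centres balls)
    resolves u v u≢v with any-ball-with-centre balls (separating u v u≢v)
    ... | c , c∈ , r , E , around , sep
      with distance connected c u | distance connected c v
    ... | a , du | b , dv = c , c∈ , a , b , du , dv , a≢b sep
      where
      a≢b : Separates u v E → a ≢ b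
      a≢b (inj₁ (u∈ , v∉)) = <⇒≢ (separated-by-ball⇒dist< around du dv u∈ v∉)
      a≢b (inj₂ (v∈ , u∉)) = <⇒≢ (separated-by-ball⇒dist< around dv du v∈ u∉) ∘ ≡.sym

  deduplicate-IsTestCover : ∀ {F} → All (IsBall G) F → (∀ u → Any (u ∈_) F) →
    (∀ u v → u ≢ v → Any (Separates u v) F) → IsTestCover G (deduplicate _≟ₛ_ F)
  deduplicate-IsTestCover balls covering separating =
      deduplicate-! _≟ₛ_ _
    , All.deduplicate⁺ _≟ₛ_ balls
    , (λ u → Any.deduplicate⁺ _≟ₛ_ (λ { refl → id }) (covering u))
    , (λ u v u≢v → Any.deduplicate⁺ _≟ₛ_ (λ { refl → id }) (separating u v u≢v))

  resolving-testCover : Connected G → ∀ {d} → IsDiameter G d → ∀ {R} → Resolving G R →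
    ∃[ F ] (IsTestCover G F × length F ≤ suc (d * ∣ R ∣))
  resolving-testCover connected {d} (diam-bound , u₀ , _) {R} resolves =
    deduplicate _≟ₛ_ family
    , deduplicate-IsTestCover balls covering separating
    , ≤-trans (length-deduplicate _≟ₛ_ family) (≤-reflexive (cong suc size))
    where
    layers : List (Subset n)
    layers = cartesianProductWith ball (elements R) (upTo d)

    family : List (Subset n)
    family = ball u₀ d ∷ layers

    size : length layers ≡ d * ∣ R ∣
    size = trans (length-cartesianProductWith ball (elements R) (upTo d))
      (trans (cong₂ _*_ (length-elements R) (length-upTo d)) (*-comm ∣ R ∣ d))

    balls : All (IsBall G) family
    balls = ball-IsBall u₀ d
      ∷ All.cartesianProductWith⁺ (setoid (Fin n)) (setoid ℕ) ball (elements R) (upTo d)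
          (λ {x} {r} _ _ → ball-IsBall x r)

    covering : ∀ u → Any (u ∈_) family
    covering u with distance connected u₀ u
    ... | a , du = here (from (ball-BallAround u₀ d u) (a , diam-bound u₀ u a du , proj₁ du))

    layer-separating : ∀ {x u v a b} → x ∈ R → IsDist G x u a → IsDist G x v b → a < b →
      Any (Separates u v) family
    layer-separating {x} x∈R du dv a<b = there
      (Any.cartesianProductWith⁺ ball (λ { refl refl → dist<⇒separated-by-ball du dv a<b })
        (∈-elements⁺ R x∈R) (∈-upTo⁺ (<-≤-trans a<b (diam-bound x _ _ dv))))

    separating : ∀ u v → u ≢ v → Any (Separates u v) family
    separating u v u≢v with resolves u v u≢v
    ... | x , x∈R , a , b , du , dv , a≢b with <-cmp a b
    ... | tri< a<b _ _ = layer-separating x∈R du dv a<b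
    ... | tri≈ _ a≡b _ = ⊥-elim (a≢b a≡b)
    ... | tri> _ _ b<a = Any.map swap (layer-separating x∈R dv du b<a)

proposition3 : ∀ {n} (G : Graph n) → Connected G →
    ∀ d k t → IsDiameter G d → IsMetricDimension G k → IsTC G t →
    (t ∸ 1 ≤ d * k) × (k ≤ t)
proposition3 G connected d k t diameter ((R , resolves , refl) , k-min) ((F , cover , refl) , t-min)
  with resolving-testCover G connected diameter resolves | centres-resolving G connected cover
... | F′ , cover′ , F′-size | R′ , resolves′ , R′-size =
  ∸-monoˡ-≤ 1 (≤-trans (t-min F′ cover′) F′-size) , ≤-trans (k-min R′ resolves′) R′-size
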